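{- For $n\ge 1$ and $w_0=(n,n-1,\dots,2,1)\in\mathfrak{S}_n$, we have $|\mathcal{O}_{\mathrm{MVP}_n}^{ -1}(w_0)| = |\mathcal{M}_n|$, the number of Motzkin paths of length $n$.
   Context: A Motzkin path of length $n$ is a lattice path from $(0,0)$ to $(n,0)$ with steps $(1,0)$, $(1,1)$, $(1,-1)$ that never goes below the $x$-axis; $\mathcal{M}_n$ is the set of them. Spots $1,\dots,n$ on a one-way street; cars $1,\dots,n$ arrive in order with preferences $\alpha=(a_1,\dots,a_n)\in[n]^n$. MVP parking rule: when car $i$ arrives, if spot $a_i$ is unoccupied, car $i$ parks there; if spot $a_i$ is occupied by an earlier car $j$, then car $i$ parks in spot $a_i$ and car $j$ is bumped and parks in the first unoccupied spot among $a_i+1,\dots,n$, if any (otherwise car $j$ fails to park); a bumped car never bumps another car. $\alpha$ is an MVP parking function if all cars park; its outcome $\mathcal{O}_{\mathrm{MVP}_n}(\alpha)$ is the permutation (in one-line notation) whose $j$th entry is the car parked in spot $j$. $\mathcal{O}_{\mathrm{MVP}_n}^{ -1}(\pi)$ is the set of MVP parking functions of length $n$ with outcome $\pi$. -}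

module Defs where

open import Data.Nat using (ℕ; zero; suc; _+_; _<ᵇ_; _≡ᵇ_)
open import Data.Bool using (Bool; true; false; _∧_; if_then_else_)
open import Data.List using (List; []; _∷_; map; concatMap; length; filterᵇ; reverse; upTo)
open import Data.Maybe using (Maybe; just; nothing)

eqList : List ℕ → List ℕ → Bool
eqList []       []       = true
eqList (x ∷ xs) (y ∷ ys) = (x ≡ᵇ y) ∧ eqList xs ys
eqList _        _        = false

words : {A : Set} → List A → ℕ → List (List A)
words alph zero    = [] ∷ []
words alph (suc k) = concatMap (λ a → map (a ∷_) (words alph k)) alph

oneTo : ℕ → List ℕ
oneTo n = map suc (upTo n)

prefSeqs : ℕ → List (List ℕ)
prefSeqs n = words (oneTo n) n

data Step : Set where
  U F D : Step   -- (1,1), (1,0), (1,-1)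

motzkinFrom : ℕ → List Step → Bool
motzkinFrom zero    []       = true
motzkinFrom (suc h) []       = false
motzkinFrom h       (U ∷ s)  = motzkinFrom (suc h) s
motzkinFrom h       (F ∷ s)  = motzkinFrom h s
motzkinFrom zero    (D ∷ s)  = false
motzkinFrom (suc h) (D ∷ s)  = motzkinFrom h s

isMotzkin : List Step → Bool
isMotzkin = motzkinFrom zero

Motzkin : ℕ → List (List Step)
Motzkin n = filterᵇ isMotzkin (words (U ∷ F ∷ D ∷ []) n)

-- MVP parking
-- A street state is a list of spots (spot 1 first); each spot is empty
-- (nothing) or holds a car (just c).

Street : Set
Street = List (Maybe ℕ)

parkFirstFree : ℕ → Street → Maybe Street
parkFirstFree j []              = nothing
parkFirstFree j (nothing ∷ s)   = just (just j ∷ s)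
parkFirstFree j (just c ∷ s)    with parkFirstFree j s
... | nothing = nothing
... | just s' = just (just c ∷ s')

-- car i arrives preferring spot (suc k), i.e. 0-based position k.
-- nothing means some car fails to park.
arrive : ℕ → ℕ → Street → Maybe Street
arrive i k       []             = nothing
arrive i zero    (nothing ∷ s)  = just (just i ∷ s)
arrive i zero    (just j ∷ s)   with parkFirstFree j s
... | nothing = nothing
... | just s' = just (just i ∷ s')
arrive i (suc k) (x ∷ s)        with arrive i k s
... | nothing = nothing
... | just s' = just (x ∷ s')

emptyStreet : ℕ → Street
emptyStreet zero    = []
emptyStreet (suc n) = nothing ∷ emptyStreet n

runFrom : ℕ → List ℕ → Street → Maybe Street
runFrom i []            s = just s
runFrom i (zero  ∷ as)  s = nothing        -- preference 0 is not a spot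
runFrom i (suc a ∷ as)  s with arrive i a s
... | nothing = nothing
... | just s' = runFrom (suc i) as s'

readOff : Street → Maybe (List ℕ)
readOff []             = just []
readOff (nothing ∷ s)  = nothing
readOff (just c ∷ s)   with readOff s
... | nothing = nothing
... | just cs = just (c ∷ cs)

-- 𝒪_MVP_n(α): just π if α is an MVP parking function of length n with
-- outcome π (π j = car parked in spot j), nothing otherwise.
outcomeMVP : (n : ℕ) → List ℕ → Maybe (List ℕ)
outcomeMVP n α with runFrom 1 α (emptyStreet n)
... | nothing = nothing
... | just s  = readOff s

hasOutcome : ℕ → List ℕ → List ℕ → Bool
hasOutcome n π α with outcomeMVP n α
... | nothing = false
... | just σ  = eqList σ π

fiberMVP : (n : ℕ) → List ℕ → List (List ℕ)
fiberMVP n π = filterᵇ (hasOutcome n π) (prefSeqs n)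

w₀ : ℕ → List ℕ
w₀ n = reverse (oneTo n)

-- Count, car by car, the preference lists that still lead to w₀, i.e. to car j on spot n ∸ j
-- (spots numbered from 0). After c arrivals this is possible only from a street of a rigid
-- shape: every car j ≤ c already stands on its final spot, except for "pending" cars
-- o₁ < ⋯ < oᵣ parked further left, each preceded by a run of gᵢ empty spots, with a run of
-- d empty spots after oᵣ. Car c + 1 must end on the spot just left of the cars ≤ c. If d > 0
-- it either parks there, or parks inside the last run, splitting it into runs of t and
-- d − 1 − t spots and becoming pending itself; if d = 0 it must bump oᵣ, which rolls on into
-- its own empty final spot. Every other choice leaves some car that can never get home. Hence
-- the number of completions is M(g₁) ⋯ M(gᵣ) · M(d), by the Motzkin recurrence
-- M(d + 1) = M(d) + Σₜ M(t) M(d − 1 − t); the empty street (r = 0, d = n) gives M(n).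

module Submission where

open import Data.Bool using (Bool; true; false; if_then_else_; _∨_)
open import Data.Unit using (⊤; tt)
open import Data.Empty using (⊥-elim)
open import Data.Maybe using (Maybe; just; nothing)
open import Data.Maybe.Properties using (just-injective)
open import Data.Product using (Σ; _×_; _,_; proj₁; proj₂; map₂)
open import Data.Sum using (_⊎_; inj₁; inj₂)
open import Data.List using (List; []; _∷_; _++_; map; concatMap; length; filterᵇ; applyUpTo; applyDownFrom; upTo; downFrom; reverse)
open import Data.List.Properties using (++-assoc; ++-identityʳ; length-++; reverse-map; reverse-upTo; map-downFrom)
open import Data.Nat
open import Data.Nat.Induction using (<-rec)
open import Data.Nat.Properties
open import Algebra.Properties.CommutativeSemigroup +-commutativeSemigroup
  using () renaming (interchange to +-interchange)
open import Function using (_∘_)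
open import Relation.Binary.PropositionalEquality
open import Relation.Nullary using (¬_; yes; no; does)
open import Relation.Nullary.Decidable using (dec-true; dec-false)
open import Relation.Binary.Definitions using (tri<; tri≈; tri>)
open ≡-Reasoning

open import Defs

private
  variable
    A B : Set

count : (A → Bool) → List A → ℕ
count p []       = 0
count p (x ∷ xs) = if p x then suc (count p xs) else count p xs

length-filterᵇ : (p : A → Bool) (xs : List A) → length (filterᵇ p xs) ≡ count p xs
length-filterᵇ p []       = refl
length-filterᵇ p (x ∷ xs) with p x
... | true  = cong suc (length-filterᵇ p xs)
... | false = length-filterᵇ p xs

count-++ : (p : A → Bool) (xs ys : List A) → count p (xs ++ ys) ≡ count p xs + count p ys
count-++ p []       ys = refl
count-++ p (x ∷ xs) ys with p x
... | true  = cong suc (count-++ p xs ys)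
... | false = count-++ p xs ys

count-map : (p : B → Bool) (f : A → B) (xs : List A) → count p (map f xs) ≡ count (p ∘ f) xs
count-map p f []       = refl
count-map p f (x ∷ xs) with p (f x)
... | true  = cong suc (count-map p f xs)
... | false = count-map p f xs

count-cong : {p q : A → Bool} → (∀ x → p x ≡ q x) → (xs : List A) → count p xs ≡ count q xs
count-cong p≗q []       = refl
count-cong {q = q} p≗q (x ∷ xs) rewrite p≗q x =
  cong (λ r → if q x then suc r else r) (count-cong p≗q xs)

count-false : {p : A → Bool} → (∀ x → p x ≡ false) → (xs : List A) → count p xs ≡ 0
count-false p≡false []       = refl
count-false p≡false (x ∷ xs) rewrite p≡false x = count-false p≡false xs

∑ : ℕ → (ℕ → ℕ) → ℕ
∑ zero    f = 0
∑ (suc n) f = f 0 + ∑ n (f ∘ suc)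

infix 5 ∑
syntax ∑ n (λ k → e) = ∑[ k < n ] e

∑-cong : ∀ n {f g : ℕ → ℕ} → (∀ k → k < n → f k ≡ g k) → ∑ n f ≡ ∑ n g
∑-cong zero    f≗g = refl
∑-cong (suc n) f≗g = cong₂ _+_ (f≗g 0 z<s) (∑-cong n (λ k k<n → f≗g (suc k) (s<s k<n)))

∑-zero : ∀ n {f : ℕ → ℕ} → (∀ k → k < n → f k ≡ 0) → ∑ n f ≡ 0
∑-zero n f≗0 = trans (∑-cong n f≗0) (∑-const0 n)
  where
  ∑-const0 : ∀ n → ∑[ k < n ] 0 ≡ 0
  ∑-const0 zero    = refl
  ∑-const0 (suc n) = ∑-const0 n

∑-+ : ∀ m n (f : ℕ → ℕ) → ∑ (m + n) f ≡ ∑ m f + (∑[ k < n ] f (m + k))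
∑-+ zero    n f = refl
∑-+ (suc m) n f = trans (cong (f 0 +_) (∑-+ m n (f ∘ suc))) (sym (+-assoc (f 0) _ _))

∑-*ˡ : ∀ n a (f : ℕ → ℕ) → ∑[ k < n ] a * f k ≡ a * ∑ n f
∑-*ˡ zero    a f = sym (*-zeroʳ a)
∑-*ˡ (suc n) a f = trans (cong (a * f 0 +_) (∑-*ˡ n a (f ∘ suc))) (sym (*-distribˡ-+ a (f 0) _))

∑-suc : ∀ n (f : ℕ → ℕ) → ∑ (suc n) f ≡ ∑ n f + f n
∑-suc zero    f = +-identityʳ (f 0)
∑-suc (suc n) f = trans (cong (f 0 +_) (∑-suc n (f ∘ suc))) (sym (+-assoc (f 0) _ _))

∑-window : ∀ a b c (f : ℕ → ℕ) → (∀ k → k < a → f k ≡ 0) → (∀ k → k < c → f (a + (b + k)) ≡ 0) →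
           ∑ (a + (b + c)) f ≡ ∑[ k < b ] f (a + k)
∑-window a b c f before after = begin
  ∑ (a + (b + c)) f
    ≡⟨ ∑-+ a (b + c) f ⟩
  ∑ a f + (∑[ k < b + c ] f (a + k))
    ≡⟨ cong₂ _+_ (∑-zero a before) (∑-+ b c (λ k → f (a + k))) ⟩
  0 + ((∑[ k < b ] f (a + k)) + (∑[ k < c ] f (a + (b + k))))
    ≡⟨ cong ((∑[ k < b ] f (a + k)) +_) (∑-zero c after) ⟩
  (∑[ k < b ] f (a + k)) + 0
    ≡⟨ +-identityʳ _ ⟩
  ∑[ k < b ] f (a + k)
    ∎

count-concatMap-oneTo : ∀ n (p : B → Bool) (f : ℕ → List B) →
  count p (concatMap f (oneTo n)) ≡ ∑[ k < n ] count p (f (suc k))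
count-concatMap-oneTo n p f = go n (λ k → k)
  where
  go : ∀ n g → count p (concatMap f (map suc (applyUpTo g n))) ≡ ∑[ k < n ] count p (f (suc (g k)))
  go zero    g = refl
  go (suc n) g = trans (count-++ p (f (suc (g 0))) _) (cong (count p (f (suc (g 0))) +_) (go n (g ∘ suc)))

-- Convolution of sequences

infixl 7 _∗_

_∗_ : (ℕ → ℕ) → (ℕ → ℕ) → ℕ → ℕ
(f ∗ g) zero    = f 0 * g 0
(f ∗ g) (suc k) = f 0 * g (suc k) + ((f ∘ suc) ∗ g) k

shift : (ℕ → ℕ) → ℕ → ℕ
shift f zero    = 0
shift f (suc k) = f k

∗-cong : ∀ k {f f′ g g′ : ℕ → ℕ} → (∀ i → i ≤ k → f i ≡ f′ i) → (∀ i → i ≤ k → g i ≡ g′ i) →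
         (f ∗ g) k ≡ (f′ ∗ g′) k
∗-cong zero    f≗f′ g≗g′ = cong₂ _*_ (f≗f′ 0 z≤n) (g≗g′ 0 z≤n)
∗-cong (suc k) f≗f′ g≗g′ =
  cong₂ _+_ (cong₂ _*_ (f≗f′ 0 z≤n) (g≗g′ (suc k) ≤-refl))
            (∗-cong k (λ i i≤k → f≗f′ (suc i) (s≤s i≤k)) (λ i i≤k → g≗g′ i (m≤n⇒m≤1+n i≤k)))

∗-distribʳ-+ : ∀ k (f f′ g : ℕ → ℕ) → ((λ i → f i + f′ i) ∗ g) k ≡ (f ∗ g) k + (f′ ∗ g) k
∗-distribʳ-+ zero    f f′ g = *-distribʳ-+ (g 0) (f 0) (f′ 0)
∗-distribʳ-+ (suc k) f f′ g = trans
  (cong₂ _+_ (*-distribʳ-+ (g (suc k)) (f 0) (f′ 0)) (∗-distribʳ-+ k (f ∘ suc) (f′ ∘ suc) g))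
  (+-interchange (f 0 * g (suc k)) _ _ _)

∗-*ˡ : ∀ k a (f g : ℕ → ℕ) → ((λ i → a * f i) ∗ g) k ≡ a * (f ∗ g) k
∗-*ˡ zero    a f g = *-assoc a (f 0) (g 0)
∗-*ˡ (suc k) a f g = trans
  (cong₂ _+_ (*-assoc a (f 0) (g (suc k))) (∗-*ˡ k a (f ∘ suc) g))
  (sym (*-distribˡ-+ a _ _))

∗-assoc : ∀ k (f g h : ℕ → ℕ) → ((f ∗ g) ∗ h) k ≡ (f ∗ (g ∗ h)) k
∗-assoc zero    f g h = *-assoc (f 0) (g 0) (h 0)
∗-assoc (suc k) f g h = begin
  f 0 * g 0 * h (suc k) + ((λ j → f 0 * g (suc j) + ((f ∘ suc) ∗ g) j) ∗ h) k
    ≡⟨ cong (f 0 * g 0 * h (suc k) +_) (∗-distribʳ-+ k _ _ h) ⟩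
  f 0 * g 0 * h (suc k) + (((λ j → f 0 * g (suc j)) ∗ h) k + (((f ∘ suc) ∗ g) ∗ h) k)
    ≡⟨ cong₂ (λ a b → f 0 * g 0 * h (suc k) + (a + b)) (∗-*ˡ k (f 0) (g ∘ suc) h) (∗-assoc k (f ∘ suc) g h) ⟩
  f 0 * g 0 * h (suc k) + (f 0 * ((g ∘ suc) ∗ h) k + ((f ∘ suc) ∗ (g ∗ h)) k)
    ≡⟨ sym (+-assoc (f 0 * g 0 * h (suc k)) _ _) ⟩
  f 0 * g 0 * h (suc k) + f 0 * ((g ∘ suc) ∗ h) k + ((f ∘ suc) ∗ (g ∗ h)) k
    ≡⟨ cong (_+ ((f ∘ suc) ∗ (g ∗ h)) k) (trans
         (cong (_+ f 0 * ((g ∘ suc) ∗ h) k) (*-assoc (f 0) (g 0) (h (suc k))))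
         (sym (*-distribˡ-+ (f 0) _ _))) ⟩
  f 0 * (g ∗ h) (suc k) + ((f ∘ suc) ∗ (g ∗ h)) k
    ∎

∗-shift : ∀ k (f g : ℕ → ℕ) → (f ∗ shift g) k ≡ shift (f ∗ g) k
∗-shift zero    f g = *-zeroʳ (f 0)
∗-shift (suc zero)    f g = trans (cong (f 0 * g 0 +_) (*-zeroʳ (f 1))) (+-identityʳ _)
∗-shift (suc (suc k)) f g = cong (f 0 * g (suc k) +_) (∗-shift (suc k) (f ∘ suc) g)

∗-∑ : ∀ k (f g : ℕ → ℕ) → (f ∗ g) k ≡ ∑[ t < suc k ] f t * g (k ∸ t)
∗-∑ zero    f g = sym (+-identityʳ _)
∗-∑ (suc k) f g = cong (f 0 * g (suc k) +_) (∗-∑ k (f ∘ suc) g)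

∗-shift-assoc : ∀ k (f g h : ℕ → ℕ) → (f ∗ shift (g ∗ h)) k ≡ (shift (f ∗ g) ∗ h) k
∗-shift-assoc zero    f g h = *-zeroʳ (f 0)
∗-shift-assoc (suc k) f g h = trans (∗-shift (suc k) f (g ∗ h)) (sym (∗-assoc k f g h))

-- Motzkin numbers

steps : List Step
steps = U ∷ F ∷ D ∷ []

walks : ℕ → ℕ → ℕ
walks h k = count (motzkinFrom h) (words steps k)

motzkin : ℕ → ℕ
motzkin = walks 0

walksBelow : ℕ → ℕ → ℕ
walksBelow zero    k = 0
walksBelow (suc h) k = walks h k

walks-suc : ∀ h k → walks h (suc k) ≡ walks (suc h) k + (walks h k + walksBelow h k)
walks-suc h k =
  trans (count-++ (motzkinFrom h) (map (U ∷_) W) _)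
    (cong₂ _+_ (up h)
      (trans (count-++ (motzkinFrom h) (map (F ∷_) W) _)
        (cong₂ _+_ (flat h)
          (trans (count-++ (motzkinFrom h) (map (D ∷_) W) []) (trans (+-identityʳ _) (down h))))))
  where
  W = words steps k
  up : ∀ h → count (motzkinFrom h) (map (U ∷_) W) ≡ walks (suc h) k
  up zero    = count-map _ _ W
  up (suc h) = count-map _ _ W
  flat : ∀ h → count (motzkinFrom h) (map (F ∷_) W) ≡ walks h k
  flat zero    = count-map _ _ W
  flat (suc h) = count-map _ _ W
  down : ∀ h → count (motzkinFrom h) (map (D ∷_) W) ≡ walksBelow h k
  down zero    = trans (count-map _ _ W) (count-false (λ _ → refl) W)
  down (suc h) = count-map _ _ W

motzkin-suc-walks : ∀ k → motzkin (suc k) ≡ walks 1 k + motzkin k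
motzkin-suc-walks k = trans (walks-suc 0 k) (cong (walks 1 k +_) (+-identityʳ _))

-- In generating functions W_{h+1} = x · M · W_h, obtained from walks-suc by strong induction.
walks-height : ∀ j h → walks (suc h) j ≡ shift (motzkin ∗ walks h) j
walks-height = <-rec _ step
  where
  step : ∀ j → (∀ {i} → i < j → ∀ h → walks (suc h) i ≡ shift (motzkin ∗ walks h) i) →
         ∀ h → walks (suc h) j ≡ shift (motzkin ∗ walks h) j
  step zero          IH h = refl
  step (suc zero)    IH h = sym (+-identityʳ _)
  step (suc (suc k)) IH h = begin
    walks (suc h) (suc (suc k))
      ≡⟨ walks-suc (suc h) (suc k) ⟩
    walks (suc (suc h)) (suc k) + (walks (suc h) (suc k) + walks h (suc k))
      ≡⟨ cong₂ (λ a b → a + (b + walks h (suc k))) (IH ≤-refl (suc h)) (IH ≤-refl h) ⟩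
    (motzkin ∗ walks (suc h)) k + ((motzkin ∗ walks h) k + walks h (suc k))
      ≡⟨ cong (_+ ((motzkin ∗ walks h) k + walks h (suc k))) convolve ⟩
    (walks 1 ∗ walks h) k + ((motzkin ∗ walks h) k + walks h (suc k))
      ≡⟨ trans (sym (+-assoc ((walks 1 ∗ walks h) k) _ _)) (+-comm _ (walks h (suc k))) ⟩
    walks h (suc k) + ((walks 1 ∗ walks h) k + (motzkin ∗ walks h) k)
      ≡⟨ cong₂ _+_ (sym (*-identityˡ _)) (sym (∗-distribʳ-+ k (walks 1) motzkin (walks h))) ⟩
    1 * walks h (suc k) + ((λ i → walks 1 i + motzkin i) ∗ walks h) k
      ≡⟨ cong (1 * walks h (suc k) +_) (∗-cong k (λ i _ → sym (motzkin-suc-walks i)) (λ _ _ → refl)) ⟩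
    shift (motzkin ∗ walks h) (suc (suc k))
      ∎
    where
    below : ∀ {i} → i ≤ k → i < suc (suc k)
    below i≤k = s≤s (m≤n⇒m≤1+n i≤k)
    convolve : (motzkin ∗ walks (suc h)) k ≡ (walks 1 ∗ walks h) k
    convolve = begin
      (motzkin ∗ walks (suc h)) k
        ≡⟨ ∗-cong k (λ _ _ → refl) (λ i i≤k → IH (below i≤k) h) ⟩
      (motzkin ∗ shift (motzkin ∗ walks h)) k
        ≡⟨ ∗-shift-assoc k motzkin motzkin (walks h) ⟩
      (shift (motzkin ∗ motzkin) ∗ walks h) k
        ≡⟨ ∗-cong k (λ i i≤k → sym (IH (below i≤k) 0)) (λ _ _ → refl) ⟩
      (walks 1 ∗ walks h) k
        ∎

motzkin-suc : ∀ e → motzkin (suc e) ≡ (∑[ t < e ] motzkin t * motzkin (e ∸ suc t)) + motzkin e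
motzkin-suc e = trans (motzkin-suc-walks e) (cong (_+ motzkin e) (trans (walks-height e 0) (shift-∗-∑ e)))
  where
  shift-∗-∑ : ∀ e → shift (motzkin ∗ motzkin) e ≡ ∑[ t < e ] motzkin t * motzkin (e ∸ suc t)
  shift-∗-∑ zero    = refl
  shift-∗-∑ (suc e) = ∗-∑ e motzkin motzkin

length-Motzkin : ∀ k → length (Motzkin k) ≡ motzkin k
length-Motzkin k = length-filterᵇ isMotzkin (words steps k)

occupant : Street → ℕ → Maybe ℕ
occupant []      r       = nothing
occupant (x ∷ s) zero    = x
occupant (x ∷ s) (suc r) = occupant s r

just≢nothing : {x : ℕ} → just x ≢ nothing
just≢nothing ()

record FirstFree (j : ℕ) (s s′ : Street) : Set where
  field
    spot     : ℕ
    was-free : occupant s spot ≡ nothing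
    parks    : occupant s′ spot ≡ just j
    earliest : ∀ r → r < length s → occupant s r ≡ nothing → spot ≤ r
    others   : ∀ r → r ≢ spot → occupant s′ r ≡ occupant s r
    length≡  : length s′ ≡ length s

parkFirstFree-spec : ∀ j s {s′} → parkFirstFree j s ≡ just s′ → FirstFree j s s′
parkFirstFree-spec j []            ()
parkFirstFree-spec j (nothing ∷ s) refl = record
  { spot = 0 ; was-free = refl ; parks = refl ; earliest = λ _ _ _ → z≤n
  ; others = λ { zero 0≢0 → ⊥-elim (0≢0 refl) ; (suc r) _ → refl } ; length≡ = refl }
parkFirstFree-spec j (just c ∷ s) eq with parkFirstFree j s in e
parkFirstFree-spec j (just c ∷ s) () | nothing
parkFirstFree-spec j (just c ∷ s) refl | just s″ = record
  { spot = suc spot ; was-free = was-free ; parks = parks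
  ; earliest = λ { zero _ () ; (suc r) (s≤s r<) free → s≤s (earliest r r< free) }
  ; others = λ { zero _ → refl ; (suc r) r≢ → others r (r≢ ∘ cong suc) }
  ; length≡ = cong suc length≡ }
  where open FirstFree (parkFirstFree-spec j s e)

record Vacant (k : ℕ) (s t : Street) : Set where
  field
    free   : occupant s k ≡ nothing
    others : ∀ r → r ≢ k → occupant t r ≡ occupant s r

record Bumps (k : ℕ) (s t : Street) : Set where
  field
    car dest  : ℕ
    bumped    : occupant s k ≡ just car
    k<dest    : k < dest
    dest-free : occupant s dest ≡ nothing
    lands     : occupant t dest ≡ just car
    earliest  : ∀ r → k < r → r < length s → occupant s r ≡ nothing → dest ≤ r
    others    : ∀ r → r ≢ k → r ≢ dest → occupant t r ≡ occupant s r

record Arrival (i k : ℕ) (s t : Street) : Set where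
  field
    length≡ : length t ≡ length s
    parks   : occupant t k ≡ just i
    cases   : Vacant k s t ⊎ Bumps k s t

arrive-spec : ∀ i k s {t} → arrive i k s ≡ just t → Arrival i k s t
arrive-spec i zero [] ()
arrive-spec i zero (nothing ∷ s) refl = record
  { length≡ = refl ; parks = refl
  ; cases = inj₁ (record { free = refl ; others = λ { zero 0≢0 → ⊥-elim (0≢0 refl) ; (suc r) _ → refl } }) }
arrive-spec i zero (just j ∷ s) eq with parkFirstFree j s in e
arrive-spec i zero (just j ∷ s) () | nothing
arrive-spec i zero (just j ∷ s) refl | just s′ = record
  { length≡ = cong suc F.length≡ ; parks = refl
  ; cases = inj₂ (record
      { car = j ; dest = suc F.spot ; bumped = refl ; k<dest = s≤s z≤n ; dest-free = F.was-free ; lands = F.parks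
      ; earliest = λ { zero () ; (suc r) _ (s≤s r<) free → s≤s (F.earliest r r< free) }
      ; others = λ { zero 0≢0 _ → ⊥-elim (0≢0 refl) ; (suc r) _ r≢ → F.others r (r≢ ∘ cong suc) } }) }
  where module F = FirstFree (parkFirstFree-spec j s e)
arrive-spec i (suc k) [] ()
arrive-spec i (suc k) (x ∷ s) eq with arrive i k s in e
arrive-spec i (suc k) (x ∷ s) () | nothing
arrive-spec i (suc k) (x ∷ s) refl | just s′ = record
  { length≡ = cong suc A.length≡ ; parks = A.parks ; cases = shiftCases A.cases }
  where
  module A = Arrival (arrive-spec i k s e)
  shiftCases : Vacant k s s′ ⊎ Bumps k s s′ → Vacant (suc k) (x ∷ s) (x ∷ s′) ⊎ Bumps (suc k) (x ∷ s) (x ∷ s′)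
  shiftCases (inj₁ v) = inj₁ (record
    { free = Vacant.free v ; others = λ { zero _ → refl ; (suc r) r≢ → Vacant.others v r (r≢ ∘ cong suc) } })
  shiftCases (inj₂ b) = inj₂ (record
    { car = B.car ; dest = suc B.dest ; bumped = B.bumped ; k<dest = s≤s B.k<dest
    ; dest-free = B.dest-free ; lands = B.lands
    ; earliest = λ { zero () ; (suc r) (s≤s k<r) (s≤s r<) free → s≤s (B.earliest r k<r r< free) }
    ; others = λ { zero _ _ → refl ; (suc r) r≢k r≢d → B.others r (r≢k ∘ cong suc) (r≢d ∘ cong suc) } })
    where module B = Bumps b

length-emptyStreet : ∀ d → length (emptyStreet d) ≡ d
length-emptyStreet zero    = refl
length-emptyStreet (suc d) = cong suc (length-emptyStreet d)

occupant-emptyStreet : ∀ d r → occupant (emptyStreet d) r ≡ nothing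
occupant-emptyStreet zero    r       = refl
occupant-emptyStreet (suc d) zero    = refl
occupant-emptyStreet (suc d) (suc r) = occupant-emptyStreet d r

occupant-emptyStreet-++ : ∀ d Y {r} → r < d → occupant (emptyStreet d ++ Y) r ≡ nothing
occupant-emptyStreet-++ (suc d) Y {zero}  _         = refl
occupant-emptyStreet-++ (suc d) Y {suc r} (s≤s r<d) = occupant-emptyStreet-++ d Y r<d

emptyStreet-suc-++ : ∀ e Y → emptyStreet (suc e) ++ Y ≡ emptyStreet e ++ (nothing ∷ Y)
emptyStreet-suc-++ zero    Y = refl
emptyStreet-suc-++ (suc e) Y = cong (nothing ∷_) (emptyStreet-suc-++ e Y)

emptyStreet-split : ∀ t f Y → emptyStreet (t + suc (suc f)) ++ Y ≡ emptyStreet t ++ (nothing ∷ (emptyStreet f ++ (nothing ∷ Y)))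
emptyStreet-split zero    f Y = cong (nothing ∷_) (emptyStreet-suc-++ f Y)
emptyStreet-split (suc t) f Y = cong (nothing ∷_) (emptyStreet-split t f Y)

occupant-++ʳ : ∀ X Y {r k} → length X + r ≡ k → occupant (X ++ Y) k ≡ occupant Y r
occupant-++ʳ []      Y refl = refl
occupant-++ʳ (x ∷ X) Y refl = occupant-++ʳ X Y refl

arrive-++ʳ : ∀ i X {k Y t p} → length X + k ≡ p → arrive i k Y ≡ just t → arrive i p (X ++ Y) ≡ just (X ++ t)
arrive-++ʳ i X {k} {Y} {t} refl parks = skip X
  where
  skip : ∀ X → arrive i (length X + k) (X ++ Y) ≡ just (X ++ t)
  skip []      = parks
  skip (x ∷ X) rewrite skip X = refl

arrive-bumps-head : ∀ i j {R R′} → parkFirstFree j R ≡ just R′ → arrive i 0 (just j ∷ R) ≡ just (just i ∷ R′)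
arrive-bumps-head i j bumped rewrite bumped = refl

-- Good streets

-- A pending entry (g , o) stands for g empty spots followed by car o, which is parked
-- before its final spot and still has to be bumped there; the head of the list is the
-- rightmost entry.
Pending : Set
Pending = List (ℕ × ℕ)

isPending : ℕ → Pending → Bool
isPending x []             = false
isPending x ((_ , o) ∷ ps) = does (x ≟ o) ∨ isPending x ps

Descending : ℕ → Pending → Set
Descending b []             = ⊤
Descending b ((_ , o) ∷ ps) = 1 ≤ o × o ≤ b × Descending (pred o) ps

pendingZone : Pending → Street
pendingZone []             = []
pendingZone ((g , o) ∷ ps) = pendingZone ps ++ (emptyStreet g ++ (just o ∷ []))

finalZone : ℕ → Pending → Street
finalZone zero    ps = []
finalZone (suc c) ps = (if isPending (suc c) ps then nothing else just (suc c)) ∷ finalZone c ps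

isPending-head : ∀ g o ps → isPending o ((g , o) ∷ ps) ≡ true
isPending-head g o ps = cong (_∨ isPending o ps) (dec-true (o ≟ o) refl)

isPending-above : ∀ b ps x → Descending b ps → b < x → isPending x ps ≡ false
isPending-above b []             x _              _   = refl
isPending-above b ((g , o) ∷ ps) x (_ , o≤b , ds) b<x
  rewrite dec-false (x ≟ o) (λ x≡o → <⇒≢ (≤-<-trans o≤b b<x) (sym x≡o)) =
  isPending-above (pred o) ps x ds (≤-<-trans (≤-trans pred[n]≤n o≤b) b<x)

Descending-weaken : ∀ {b b′} ps → b ≤ b′ → Descending b ps → Descending b′ ps
Descending-weaken []             _    _              = tt
Descending-weaken ((g , o) ∷ ps) b≤b′ (1≤o , o≤b , ds) = 1≤o , ≤-trans o≤b b≤b′ , ds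

finalZone-cong : ∀ c {ps ps′} → (∀ x → x ≤ c → isPending x ps ≡ isPending x ps′) → finalZone c ps ≡ finalZone c ps′
finalZone-cong zero    same = refl
finalZone-cong (suc c) same =
  cong₂ _∷_ (cong (λ b → if b then nothing else just (suc c)) (same (suc c) ≤-refl))
            (finalZone-cong c (λ x x≤c → same x (m≤n⇒m≤1+n x≤c)))

finalZone-[] : ∀ c → finalZone c [] ≡ map just (applyDownFrom suc c)
finalZone-[] zero    = refl
finalZone-[] (suc c) = cong (just (suc c) ∷_) (finalZone-[] c)

finalZone-push : ∀ c t ps → finalZone (suc c) ((t , suc c) ∷ ps) ≡ nothing ∷ finalZone c ps
finalZone-push c t ps rewrite dec-true (c ≟ c) refl = cong (nothing ∷_) (finalZone-cong c ignore-new)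
  where
  ignore-new : ∀ x → x ≤ c → isPending x ((t , suc c) ∷ ps) ≡ isPending x ps
  ignore-new x x≤c = cong (_∨ isPending x ps) (dec-false (x ≟ suc c) (λ x≡ → 1+n≰n (subst (_≤ c) x≡ x≤c)))

finalZone-home : ∀ c {b} ps → Descending b ps → b < suc c → finalZone (suc c) ps ≡ just (suc c) ∷ finalZone c ps
finalZone-home c ps ds b<sc =
  cong (λ b → (if b then nothing else just (suc c)) ∷ finalZone c ps) (isPending-above _ ps (suc c) ds b<sc)

occupant-finalZone-pending : ∀ c ps x → isPending x ps ≡ true → 1 ≤ x → x ≤ c →
  occupant (finalZone c ps) (c ∸ x) ≡ nothing
occupant-finalZone-pending zero    ps (suc x) pending 1≤x ()
occupant-finalZone-pending (suc c) ps x pending 1≤x x≤sc with m≤n⇒m<n∨m≡n x≤sc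
... | inj₂ refl rewrite n∸n≡0 (suc c) | pending = refl
... | inj₁ (s≤s x≤c) rewrite +-∸-assoc 1 x≤c = occupant-finalZone-pending c ps x pending 1≤x x≤c

-- o is the largest pending car, so its empty final spot is the first free spot of the final zone.
parkFirstFree-finalZone : ∀ c g o ps → 1 ≤ o → o ≤ c → Descending (pred o) ps →
  parkFirstFree o (finalZone c ((g , o) ∷ ps)) ≡ just (finalZone c ps)
parkFirstFree-finalZone zero    g (suc o) ps 1≤o () ds
parkFirstFree-finalZone (suc c) g o ps 1≤o o≤sc ds with m≤n⇒m<n∨m≡n o≤sc
... | inj₂ refl rewrite dec-true (c ≟ c) refl | isPending-above c ps (suc c) ds ≤-refl =
  cong (λ z → just (just (suc c) ∷ z)) (finalZone-cong c ignore-head)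
  where
  ignore-head : ∀ x → x ≤ c → isPending x ((g , suc c) ∷ ps) ≡ isPending x ps
  ignore-head x x≤c = cong (_∨ isPending x ps) (dec-false (x ≟ suc c) (λ x≡ → 1+n≰n (subst (_≤ c) x≡ x≤c)))
... | inj₁ (s≤s o≤c)
  rewrite dec-false (suc c ≟ o) (λ sc≡o → 1+n≰n (subst (_≤ c) (sym sc≡o) o≤c))
        | isPending-above (pred o) ps (suc c) ds (s≤s (≤-trans pred[n]≤n o≤c))
        | parkFirstFree-finalZone c g o ps 1≤o o≤c ds = refl

goodStreet : ℕ → Pending → ℕ → Street
goodStreet c ps d = pendingZone ps ++ (emptyStreet d ++ finalZone c ps)

pendingLength : Pending → ℕ
pendingLength ps = length (pendingZone ps)

gapWeight : Pending → ℕ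
gapWeight []             = 1
gapWeight ((g , _) ∷ ps) = motzkin g * gapWeight ps

weight : Pending → ℕ → ℕ
weight ps d = gapWeight ps * motzkin d

weight-suc : ∀ x ps e → weight ps (suc e) ≡ (∑[ t < e ] weight ((t , x) ∷ ps) (e ∸ suc t)) + weight ps e
weight-suc x ps e = begin
  G * motzkin (suc e)
    ≡⟨ cong (G *_) (motzkin-suc e) ⟩
  G * ((∑[ t < e ] motzkin t * motzkin (e ∸ suc t)) + motzkin e)
    ≡⟨ *-distribˡ-+ G _ (motzkin e) ⟩
  G * (∑[ t < e ] motzkin t * motzkin (e ∸ suc t)) + G * motzkin e
    ≡⟨ cong (_+ G * motzkin e) (∑-*ˡ e G _) ⟨
  (∑[ t < e ] G * (motzkin t * motzkin (e ∸ suc t))) + G * motzkin e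
    ≡⟨ cong (_+ G * motzkin e) (∑-cong e (λ t _ → rearrange (motzkin t) (motzkin (e ∸ suc t)))) ⟩
  (∑[ t < e ] motzkin t * G * motzkin (e ∸ suc t)) + G * motzkin e
    ∎
  where
  G = gapWeight ps
  rearrange : ∀ a b → G * (a * b) ≡ a * G * b
  rearrange a b = trans (sym (*-assoc G a b)) (cong (_* b) (*-comm G a))

weight-bump : ∀ g o ps → weight ((g , o) ∷ ps) 0 ≡ weight ps g
weight-bump g o ps = trans (*-identityʳ _) (*-comm (motzkin g) (gapWeight ps))

length-pendingZone-gap : ∀ ps g → length (pendingZone ps ++ emptyStreet g) ≡ pendingLength ps + g
length-pendingZone-gap ps g = trans (length-++ (pendingZone ps)) (cong (pendingLength ps +_) (length-emptyStreet g))

pendingLength-∷ : ∀ g o ps → pendingLength ((g , o) ∷ ps) ≡ suc (pendingLength ps + g)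
pendingLength-∷ g o ps = begin
  length (pendingZone ps ++ (emptyStreet g ++ (just o ∷ [])))  ≡⟨ cong length (++-assoc (pendingZone ps) (emptyStreet g) _) ⟨
  length ((pendingZone ps ++ emptyStreet g) ++ (just o ∷ []))  ≡⟨ length-++ (pendingZone ps ++ emptyStreet g) ⟩
  length (pendingZone ps ++ emptyStreet g) + 1                 ≡⟨ cong (_+ 1) (length-pendingZone-gap ps g) ⟩
  pendingLength ps + g + 1                                     ≡⟨ +-comm _ 1 ⟩
  suc (pendingLength ps + g)                                   ∎

pendingLength-zero : ∀ ps d → pendingLength ps + d ≡ 0 → ps ≡ [] × d ≡ 0
pendingLength-zero []             zero _  = refl , refl
pendingLength-zero ((g , o) ∷ ps) d    eq with () ← trans (sym (cong (_+ d) (pendingLength-∷ g o ps))) eq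

goodStreet-∷ : ∀ c g o ps d →
  goodStreet c ((g , o) ∷ ps) d ≡ (pendingZone ps ++ emptyStreet g) ++ (just o ∷ (emptyStreet d ++ finalZone c ((g , o) ∷ ps)))
goodStreet-∷ c g o ps d = begin
  (P ++ (E ++ (just o ∷ []))) ++ Z  ≡⟨ ++-assoc P _ Z ⟩
  P ++ ((E ++ (just o ∷ [])) ++ Z)  ≡⟨ cong (P ++_) (++-assoc E (just o ∷ []) Z) ⟩
  P ++ (E ++ (just o ∷ Z))          ≡⟨ ++-assoc P E (just o ∷ Z) ⟨
  (P ++ E) ++ (just o ∷ Z)          ∎
  where
  P = pendingZone ps
  E = emptyStreet g
  Z = emptyStreet d ++ finalZone c ((g , o) ∷ ps)

arrive-home : ∀ c ps e → Descending c ps →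
  arrive (suc c) (pendingLength ps + e) (goodStreet c ps (suc e)) ≡ just (goodStreet (suc c) ps e)
arrive-home c ps e desc = begin
  arrive (suc c) (pendingLength ps + e) (P ++ (emptyStreet (suc e) ++ Z))
    ≡⟨ cong (λ u → arrive (suc c) (pendingLength ps + e) (P ++ u)) (emptyStreet-suc-++ e Z) ⟩
  arrive (suc c) (pendingLength ps + e) (P ++ (E ++ (nothing ∷ Z)))
    ≡⟨ cong (arrive (suc c) (pendingLength ps + e)) (++-assoc P E _) ⟨
  arrive (suc c) (pendingLength ps + e) ((P ++ E) ++ (nothing ∷ Z))
    ≡⟨ arrive-++ʳ (suc c) (P ++ E) (trans (+-identityʳ _) (length-pendingZone-gap ps e)) refl ⟩
  just ((P ++ E) ++ (just (suc c) ∷ Z))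
    ≡⟨ cong just (++-assoc P E _) ⟩
  just (P ++ (E ++ (just (suc c) ∷ Z)))
    ≡⟨ cong (λ z → just (P ++ (E ++ z))) (finalZone-home c ps desc ≤-refl) ⟨
  just (goodStreet (suc c) ps e)
    ∎
  where
  P = pendingZone ps
  E = emptyStreet e
  Z = finalZone c ps

arrive-push : ∀ c ps t f →
  arrive (suc c) (pendingLength ps + t) (goodStreet c ps (t + suc (suc f))) ≡ just (goodStreet (suc c) ((t , suc c) ∷ ps) f)
arrive-push c ps t f = begin
  arrive (suc c) (pendingLength ps + t) (P ++ (emptyStreet (t + suc (suc f)) ++ Z))
    ≡⟨ cong (λ u → arrive (suc c) (pendingLength ps + t) (P ++ u)) (emptyStreet-split t f Z) ⟩
  arrive (suc c) (pendingLength ps + t) (P ++ (E ++ (nothing ∷ Y)))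
    ≡⟨ cong (arrive (suc c) (pendingLength ps + t)) (++-assoc P E _) ⟨
  arrive (suc c) (pendingLength ps + t) ((P ++ E) ++ (nothing ∷ Y))
    ≡⟨ arrive-++ʳ (suc c) (P ++ E) (trans (+-identityʳ _) (length-pendingZone-gap ps t)) refl ⟩
  just ((P ++ E) ++ (just (suc c) ∷ Y))
    ≡⟨ cong (λ z → just ((P ++ E) ++ (just (suc c) ∷ (emptyStreet f ++ z)))) (finalZone-push c t ps) ⟨
  just ((P ++ E) ++ (just (suc c) ∷ (emptyStreet f ++ finalZone (suc c) ((t , suc c) ∷ ps))))
    ≡⟨ cong just (goodStreet-∷ (suc c) t (suc c) ps f) ⟨
  just (goodStreet (suc c) ((t , suc c) ∷ ps) f)
    ∎
  where
  P = pendingZone ps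
  E = emptyStreet t
  Z = finalZone c ps
  Y = emptyStreet f ++ (nothing ∷ Z)

arrive-bump-home : ∀ c g o ps → Descending c ((g , o) ∷ ps) →
  arrive (suc c) (pendingLength ps + g) (goodStreet c ((g , o) ∷ ps) 0) ≡ just (goodStreet (suc c) ps g)
arrive-bump-home c g o ps (1≤o , o≤c , desc) = begin
  arrive (suc c) (pendingLength ps + g) (goodStreet c ((g , o) ∷ ps) 0)
    ≡⟨ cong (arrive (suc c) (pendingLength ps + g)) (goodStreet-∷ c g o ps 0) ⟩
  arrive (suc c) (pendingLength ps + g) ((P ++ E) ++ (just o ∷ finalZone c ((g , o) ∷ ps)))
    ≡⟨ arrive-++ʳ (suc c) (P ++ E) (trans (+-identityʳ _) (length-pendingZone-gap ps g))
         (arrive-bumps-head (suc c) o {R = finalZone c ((g , o) ∷ ps)} (parkFirstFree-finalZone c g o ps 1≤o o≤c desc)) ⟩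
  just ((P ++ E) ++ (just (suc c) ∷ finalZone c ps))
    ≡⟨ cong just (++-assoc P E _) ⟩
  just (P ++ (E ++ (just (suc c) ∷ finalZone c ps)))
    ≡⟨ cong (λ z → just (P ++ (E ++ z))) (finalZone-home c ps desc (s≤s (≤-trans pred[n]≤n o≤c))) ⟨
  just (goodStreet (suc c) ps g)
    ∎
  where
  P = pendingZone ps
  E = emptyStreet g

eqList-refl : ∀ xs → eqList xs xs ≡ true
eqList-refl []       = refl
eqList-refl (x ∷ xs) with x ≡ᵇ x | ≡⇒≡ᵇ x x refl
... | true | _ = eqList-refl xs

eqList-sound : ∀ xs ys → eqList xs ys ≡ true → xs ≡ ys
eqList-sound []       []       _  = refl
eqList-sound (x ∷ xs) (y ∷ ys) eq with x ≡ᵇ y | ≡ᵇ⇒≡ x y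
... | true | x≡y = cong₂ _∷_ (x≡y _) (eqList-sound xs ys eq)

readOff-map-just : ∀ xs → readOff (map just xs) ≡ just xs
readOff-map-just []       = refl
readOff-map-just (x ∷ xs) rewrite readOff-map-just xs = refl

readOff-sound : ∀ t {σ} → readOff t ≡ just σ → t ≡ map just σ
readOff-sound []            refl = refl
readOff-sound (nothing ∷ t) ()
readOff-sound (just c ∷ t)  eq with readOff t in e
readOff-sound (just c ∷ t)  refl | just σ = cong (just c ∷_) (readOff-sound t e)

w₀≡applyDownFrom : ∀ n → w₀ n ≡ applyDownFrom suc n
w₀≡applyDownFrom n = begin
  reverse (map suc (upTo n)) ≡⟨ reverse-map suc (upTo n) ⟨
  map suc (reverse (upTo n)) ≡⟨ cong (map suc) (reverse-upTo n) ⟩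
  map suc (downFrom n)       ≡⟨ map-downFrom suc n ⟩
  applyDownFrom suc n        ∎

occupant-applyDownFrom : ∀ k r {x} → occupant (map just (applyDownFrom suc k)) r ≡ just x → x ≡ k ∸ r × r < k
occupant-applyDownFrom (suc k) zero    refl = refl , z<s
occupant-applyDownFrom (suc k) (suc r) eq   = map₂ s<s (occupant-applyDownFrom k r eq)

runFrom-parks : ∀ i k s {t} β → arrive i k s ≡ just t → runFrom i (suc k ∷ β) s ≡ runFrom (suc i) β t
runFrom-parks i k s β parks rewrite parks = refl

runFrom-fails : ∀ i k s β → arrive i k s ≡ nothing → runFrom i (suc k ∷ β) s ≡ nothing
runFrom-fails i k s β fails rewrite fails = refl

module _ (n : ℕ) where

  record WellFormed (c : ℕ) (s : Street) : Set where
    field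
      length≡n  : length s ≡ n
      car-range : ∀ r x → occupant s r ≡ just x → 1 ≤ x × x ≤ c
      injective : ∀ r r′ x → occupant s r ≡ just x → occupant s r′ ≡ just x → r ≡ r′

  arrival-tracks : ∀ {i k s t} → Arrival i k s t → ∀ r x → occupant s r ≡ just x →
                   (r ≢ k × occupant t r ≡ just x) ⊎ (r ≡ k × Σ (Bumps k s t) (λ b → Bumps.car b ≡ x))
  arrival-tracks {k = k} a r x sr with Arrival.cases a | r ≟ k
  ... | inj₁ v | yes refl = ⊥-elim (just≢nothing (trans (sym sr) (Vacant.free v)))
  ... | inj₁ v | no r≢k   = inj₁ (r≢k , trans (Vacant.others v r r≢k) sr)
  ... | inj₂ b | yes refl = inj₂ (refl , (b , just-injective (trans (sym (Bumps.bumped b)) sr)))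
  ... | inj₂ b | no r≢k   = inj₁ (r≢k , trans (Bumps.others b r r≢k dest≢) sr)
    where
    dest≢ : r ≢ Bumps.dest b
    dest≢ refl = just≢nothing (trans (sym sr) (Bumps.dest-free b))

  vacant-occupant : ∀ {i k s t} → Arrival i k s t → Vacant k s t → ∀ r x → occupant t r ≡ just x →
                    (r ≡ k × x ≡ i) ⊎ (r ≢ k × occupant s r ≡ just x)
  vacant-occupant {k = k} a v r x tr with r ≟ k
  ... | yes refl = inj₁ (refl , just-injective (trans (sym tr) (Arrival.parks a)))
  ... | no r≢k   = inj₂ (r≢k , trans (sym (Vacant.others v r r≢k)) tr)

  bumps-occupant : ∀ {i k s t} → Arrival i k s t → (b : Bumps k s t) → ∀ r x → occupant t r ≡ just x →
                   (r ≡ k × x ≡ i) ⊎ ((r ≡ Bumps.dest b × x ≡ Bumps.car b) ⊎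
                                      (r ≢ k × r ≢ Bumps.dest b × occupant s r ≡ just x))
  bumps-occupant {k = k} a b r x tr with r ≟ k | r ≟ Bumps.dest b
  ... | yes refl | _        = inj₁ (refl , just-injective (trans (sym tr) (Arrival.parks a)))
  ... | no r≢k   | yes refl = inj₂ (inj₁ (refl , just-injective (trans (sym tr) (Bumps.lands b))))
  ... | no r≢k   | no r≢d   = inj₂ (inj₂ (r≢k , r≢d , trans (sym (Bumps.others b r r≢k r≢d)) tr))

  wellFormed-arrival : ∀ {c k s t} → WellFormed c s → Arrival (suc c) k s t → WellFormed (suc c) t
  wellFormed-arrival {c} {k} {s} {t} W a = record
    { length≡n = trans (Arrival.length≡ a) W.length≡n ; car-range = range ; injective = inj }
    where
    module W = WellFormed W
    fresh : ∀ r → occupant s r ≢ just (suc c)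
    fresh r sr = 1+n≰n (proj₂ (W.car-range r (suc c) sr))
    old : ∀ r x → occupant s r ≡ just x → 1 ≤ x × x ≤ suc c
    old r x sr = proj₁ (W.car-range r x sr) , m≤n⇒m≤1+n (proj₂ (W.car-range r x sr))
    range : ∀ r x → occupant t r ≡ just x → 1 ≤ x × x ≤ suc c
    range r x tr with Arrival.cases a
    ... | inj₁ v with vacant-occupant a v r x tr
    ...   | inj₁ (_ , refl)  = s≤s z≤n , ≤-refl
    ...   | inj₂ (_ , sr)    = old r x sr
    range r x tr | inj₂ b with bumps-occupant a b r x tr
    ...   | inj₁ (_ , refl)          = s≤s z≤n , ≤-refl
    ...   | inj₂ (inj₁ (_ , refl))   = old k _ (Bumps.bumped b)
    ...   | inj₂ (inj₂ (_ , _ , sr)) = old r x sr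
    inj : ∀ r r′ x → occupant t r ≡ just x → occupant t r′ ≡ just x → r ≡ r′
    inj r r′ x tr tr′ with Arrival.cases a
    ... | inj₁ v with vacant-occupant a v r x tr | vacant-occupant a v r′ x tr′
    ...   | inj₁ (refl , _) | inj₁ (refl , _) = refl
    ...   | inj₁ (_ , refl) | inj₂ (_ , sr′)  = ⊥-elim (fresh r′ sr′)
    ...   | inj₂ (_ , sr)   | inj₁ (_ , refl) = ⊥-elim (fresh r sr)
    ...   | inj₂ (_ , sr)   | inj₂ (_ , sr′)  = W.injective r r′ x sr sr′
    inj r r′ x tr tr′ | inj₂ b with bumps-occupant a b r x tr | bumps-occupant a b r′ x tr′
    ...   | inj₁ (refl , _)          | inj₁ (refl , _)          = refl
    ...   | inj₁ (_ , refl)          | inj₂ (inj₁ (_ , refl))   = ⊥-elim (fresh k (Bumps.bumped b))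
    ...   | inj₁ (_ , refl)          | inj₂ (inj₂ (_ , _ , sr′)) = ⊥-elim (fresh r′ sr′)
    ...   | inj₂ (inj₁ (_ , refl))   | inj₁ (_ , refl)          = ⊥-elim (fresh k (Bumps.bumped b))
    ...   | inj₂ (inj₂ (_ , _ , sr)) | inj₁ (_ , refl)          = ⊥-elim (fresh r sr)
    ...   | inj₂ (inj₁ (refl , _))   | inj₂ (inj₁ (refl , _))   = refl
    ...   | inj₂ (inj₁ (_ , refl))   | inj₂ (inj₂ (r′≢k , _ , sr′)) =
      ⊥-elim (r′≢k (sym (W.injective k r′ _ (Bumps.bumped b) sr′)))
    ...   | inj₂ (inj₂ (r≢k , _ , sr)) | inj₂ (inj₁ (_ , refl))  =
      ⊥-elim (r≢k (sym (W.injective k r _ (Bumps.bumped b) sr)))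
    ...   | inj₂ (inj₂ (_ , _ , sr)) | inj₂ (inj₂ (_ , _ , sr′)) = W.injective r r′ x sr sr′

  -- Doomed streets

  -- Spot n ∸ j is the final spot of car j; after c arrivals the spots from n ∸ c on form the
  -- final zone, the spots before it the open zone.
  record Misplaced (c : ℕ) (t : Street) : Set where
    field
      car spot   : ℕ
      occupies   : occupant t spot ≡ just car
      final-zone : n ∸ c ≤ spot
      not-home   : spot ≢ n ∸ car

  record Crossing (c : ℕ) (t : Street) : Set where
    field
      small big           : ℕ
      small<big           : small < big
      big≤c               : big ≤ c
      smallSpot bigSpot   : ℕ
      small-occupies      : occupant t smallSpot ≡ just small
      big-occupies        : occupant t bigSpot ≡ just big
      big-left            : bigSpot < smallSpot
      open-zone           : smallSpot < n ∸ c

  Doomed : ℕ → Street → Set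
  Doomed c t = Misplaced c t ⊎ Crossing c t

  Bad : ℕ → Street → Set
  Bad c t = WellFormed c t × Doomed c t

  arrivals-left : ∀ {c m} → c + suc m ≡ n → suc c ≤ n
  arrivals-left {c} {m} refl = subst (_≤ c + suc m) (+-comm c 1) (+-monoʳ-≤ c (s≤s z≤n))

  open-zone-length : ∀ {c m ℓ} → c + m ≡ n → ℓ ≡ m → n ∸ c ≡ ℓ
  open-zone-length {c} {m} c+m≡n ℓ≡m = trans (cong (_∸ c) (sym c+m≡n)) (trans (m+n∸m≡n c m) (sym ℓ≡m))

  n∸-shrinks : ∀ c → suc c ≤ n → n ∸ suc c < n ∸ c
  n∸-shrinks c sc≤n = ∸-monoʳ-< (n<1+n c) sc≤n

  newcomer-misplaced : ∀ {c k s t} → suc c ≤ n → n ∸ c ≤ k → Arrival (suc c) k s t → Misplaced (suc c) t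
  newcomer-misplaced {c} {k} sc≤n nc≤k a = record
    { car = suc c ; spot = k ; occupies = Arrival.parks a
    ; final-zone = ≤-trans (∸-monoʳ-≤ n (n≤1+n c)) nc≤k
    ; not-home = λ k≡ → <⇒≢ (<-≤-trans (n∸-shrinks c sc≤n) nc≤k) (sym k≡) }

  -- Whoever displaces a misplaced car is itself misplaced.
  misplaced-arrival : ∀ {c k s t} → suc c ≤ n → Misplaced c s → Arrival (suc c) k s t → Misplaced (suc c) t
  misplaced-arrival {c} sc≤n m a with arrival-tracks a (Misplaced.spot m) (Misplaced.car m) (Misplaced.occupies m)
  ... | inj₁ (_ , stays) = record
    { car = Misplaced.car m ; spot = Misplaced.spot m ; occupies = stays
    ; final-zone = ≤-trans (∸-monoʳ-≤ n (n≤1+n c)) (Misplaced.final-zone m) ; not-home = Misplaced.not-home m }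
  ... | inj₂ (refl , _) = newcomer-misplaced sc≤n (Misplaced.final-zone m) a

  crossing-or-misplaced : ∀ {c t} small big smallSpot bigSpot → small < big → big ≤ c →
    occupant t smallSpot ≡ just small → occupant t bigSpot ≡ just big → bigSpot < smallSpot →
    smallSpot ≢ n ∸ small → Doomed c t
  crossing-or-misplaced {c} small big smallSpot bigSpot s<b b≤c sm bg left not-home with smallSpot <? n ∸ c
  ... | yes open-zone = inj₂ (record
    { small = small ; big = big ; small<big = s<b ; big≤c = b≤c ; smallSpot = smallSpot ; bigSpot = bigSpot
    ; small-occupies = sm ; big-occupies = bg ; big-left = left ; open-zone = open-zone })
  ... | no closed = inj₁ (record
    { car = small ; spot = smallSpot ; occupies = sm ; final-zone = ≮⇒≥ closed ; not-home = not-home })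

  small-not-home : ∀ {c s} (X : Crossing c s) → Crossing.smallSpot X ≢ n ∸ Crossing.small X
  small-not-home X = <⇒≢ (<-≤-trans X.open-zone (∸-monoʳ-≤ n (≤-trans (n≤1+n _) (≤-trans X.small<big X.big≤c))))
    where module X = Crossing X

  -- The small car cannot be bumped past the big car's final spot before the big car reaches it.
  crossing-arrival : ∀ {c k s t} → suc c ≤ n → WellFormed c s → Crossing c s → Arrival (suc c) k s t → Doomed (suc c) t
  crossing-arrival {c} {k} {s} {t} sc≤n W X a
    with arrival-tracks a X.bigSpot X.big X.big-occupies | arrival-tracks a X.smallSpot X.small X.small-occupies
    where module X = Crossing X
  ... | inj₂ (refl , _) | inj₂ (smallSpot≡k , _) = ⊥-elim (<⇒≢ (Crossing.big-left X) (sym smallSpot≡k))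
  ... | inj₂ (refl , _) | inj₁ (_ , small-stays) =
    crossing-or-misplaced X.small (suc c) X.smallSpot k
      (≤-trans X.small<big (m≤n⇒m≤1+n X.big≤c)) ≤-refl small-stays (Arrival.parks a) X.big-left (small-not-home X)
    where module X = Crossing X
  ... | inj₁ (_ , big-stays) | inj₁ (_ , small-stays) =
    crossing-or-misplaced X.small X.big X.smallSpot X.bigSpot
      X.small<big (m≤n⇒m≤1+n X.big≤c) small-stays big-stays X.big-left (small-not-home X)
    where module X = Crossing X
  ... | inj₁ (_ , big-stays) | inj₂ (refl , (b , refl)) = small-lands
    where
    module X = Crossing X
    module B = Bumps b
    module W = WellFormed W
    big≤n : X.big ≤ n
    big≤n = ≤-trans X.big≤c (≤-trans (n≤1+n c) sc≤n)
    bigHome = n ∸ X.big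
    k<bigHome : k < bigHome
    k<bigHome = <-≤-trans X.open-zone (∸-monoʳ-≤ n X.big≤c)
    bigHome<length : bigHome < length s
    bigHome<length = subst (bigHome <_) (sym W.length≡n)
                           (∸-monoʳ-< {o = 0} (proj₁ (W.car-range X.bigSpot X.big X.big-occupies)) big≤n)
    small-lands : Doomed (suc c) t
    small-lands with occupant s bigHome in home
    ... | nothing = crossing-or-misplaced X.small X.big B.dest X.bigSpot
      X.small<big (m≤n⇒m≤1+n X.big≤c) B.lands big-stays (<-trans X.big-left B.k<dest)
      (<⇒≢ (≤-<-trans (B.earliest bigHome k<bigHome bigHome<length home) (∸-monoʳ-< X.small<big big≤n)))
    ... | just x with x ≟ X.big
    ...   | yes refl = ⊥-elim (<⇒≢ (<-trans X.big-left k<bigHome) (W.injective X.bigSpot bigHome X.big X.big-occupies home))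
    ...   | no x≢big = inj₁ (misplaced-arrival sc≤n intruder a)
      where
      x≤n : x ≤ n
      x≤n = ≤-trans (proj₂ (W.car-range bigHome x home)) (≤-trans (n≤1+n c) sc≤n)
      intruder : Misplaced c s
      intruder = record
        { car = x ; spot = bigHome ; occupies = home ; final-zone = ∸-monoʳ-≤ n X.big≤c
        ; not-home = λ eq → x≢big (sym (∸-cancelˡ-≡ big≤n x≤n eq)) }

  bad-arrival : ∀ {c k s t} → suc c ≤ n → Bad c s → Arrival (suc c) k s t → Bad (suc c) t
  bad-arrival sc≤n (W , inj₁ m) a = wellFormed-arrival W a , inj₁ (misplaced-arrival sc≤n m a)
  bad-arrival sc≤n (W , inj₂ X) a = wellFormed-arrival W a , crossing-arrival sc≤n W X a

  isW₀ : Maybe (List ℕ) → Bool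
  isW₀ nothing  = false
  isW₀ (just σ) = eqList σ (w₀ n)

  succeeds : Maybe Street → Bool
  succeeds nothing  = false
  succeeds (just t) = isW₀ (readOff t)

  hasOutcome-w₀ : ∀ α → hasOutcome n (w₀ n) α ≡ succeeds (runFrom 1 α (emptyStreet n))
  hasOutcome-w₀ α with runFrom 1 α (emptyStreet n)
  ... | nothing = refl
  ... | just t with readOff t
  ...   | nothing = refl
  ...   | just σ  = refl

  completions : ℕ → Street → ℕ → ℕ
  completions i s m = count (λ β → succeeds (runFrom i β s)) (words (oneTo n) m)

  completionsVia : ℕ → Street → ℕ → ℕ → ℕ
  completionsVia i s m k = count (λ β → succeeds (runFrom i (suc k ∷ β) s)) (words (oneTo n) m)

  completions-suc : ∀ i s m → completions i s (suc m) ≡ ∑[ k < n ] completionsVia i s m k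
  completions-suc i s m = trans
    (count-concatMap-oneTo n (λ β → succeeds (runFrom i β s)) (λ a → map (a ∷_) (words (oneTo n) m)))
    (∑-cong n (λ k _ → count-map _ (suc k ∷_) (words (oneTo n) m)))

  completionsVia-park : ∀ i s m k {t} → arrive i k s ≡ just t → completionsVia i s m k ≡ completions (suc i) t m
  completionsVia-park i s m k parks = count-cong (λ β → cong succeeds (runFrom-parks i k s β parks)) (words (oneTo n) m)

  completionsVia-null : ∀ i s m k → (∀ t → arrive i k s ≡ just t → completions (suc i) t m ≡ 0) →
                        completionsVia i s m k ≡ 0
  completionsVia-null i s m k null = by-arrival (arrive i k s) refl
    where
    by-arrival : ∀ r → arrive i k s ≡ r → completionsVia i s m k ≡ 0
    by-arrival nothing  fails = count-false (λ β → cong succeeds (runFrom-fails i k s β fails)) (words (oneTo n) m)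
    by-arrival (just t) parks = trans (completionsVia-park i s m k parks) (null t parks)

  succeeds-doomed : ∀ t → Doomed n t → succeeds (just t) ≡ false
  succeeds-doomed t doomed with readOff t in r
  ... | nothing = refl
  ... | just σ with eqList σ (w₀ n) in e
  ...   | false = refl
  ...   | true  = ⊥-elim (impossible doomed)
    where
    t≡w₀ : t ≡ map just (applyDownFrom suc n)
    t≡w₀ = trans (readOff-sound t r) (cong (map just) (trans (eqList-sound σ (w₀ n) e) (w₀≡applyDownFrom n)))
    impossible : ¬ Doomed n t
    impossible (inj₁ m) = Misplaced.not-home m (sym (trans (cong (n ∸_) car≡) (m∸[m∸n]≡n (<⇒≤ spot<n))))
      where
      home = occupant-applyDownFrom n (Misplaced.spot m) (subst (λ u → occupant u _ ≡ _) t≡w₀ (Misplaced.occupies m))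
      car≡ = proj₁ home
      spot<n = proj₂ home
    impossible (inj₂ X) with () ← subst (Crossing.smallSpot X <_) (n∸n≡0 n) (Crossing.open-zone X)

  succeeds-finalZone : succeeds (just (finalZone n [])) ≡ true
  succeeds-finalZone
    rewrite finalZone-[] n | readOff-map-just (applyDownFrom suc n) | w₀≡applyDownFrom n = eqList-refl (applyDownFrom suc n)

  completions-bad : ∀ m c t → c + m ≡ n → Bad c t → completions (suc c) t m ≡ 0
  completions-bad zero c t c+0≡n (_ , doomed)
    rewrite succeeds-doomed t (subst (λ c → Doomed c t) (trans (sym (+-identityʳ c)) c+0≡n) doomed) = refl
  completions-bad (suc m) c t c+m≡n bad = trans (completions-suc (suc c) t m)
    (∑-zero n (λ k _ → completionsVia-null (suc c) t m k (λ t′ parks →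
      completions-bad m (suc c) t′ (trans (sym (+-suc c m)) c+m≡n)
        (bad-arrival (arrivals-left c+m≡n) bad (arrive-spec _ _ _ parks)))))

  completionsVia-doomed : ∀ {c m} s k → suc c + m ≡ n → WellFormed c s →
    (∀ {t} → Arrival (suc c) k s t → Doomed (suc c) t) → completionsVia (suc c) s m k ≡ 0
  completionsVia-doomed {c} {m} s k sc+m≡n W doomed = completionsVia-null (suc c) s m k (λ t parks →
    let a = arrive-spec _ _ _ parks in completions-bad m (suc c) t sc+m≡n (wellFormed-arrival W a , doomed a))

  module LastPending {c g o ps d} (sc≤n : suc c ≤ n) (n∸c≡ : n ∸ c ≡ pendingLength ((g , o) ∷ ps) + d)
                     (desc : Descending c ((g , o) ∷ ps)) (W : WellFormed c (goodStreet c ((g , o) ∷ ps) d)) where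

    s = goodStreet c ((g , o) ∷ ps) d
    β = pendingLength ps + g
    oHome = n ∸ o
    module W = WellFormed W

    1≤o : 1 ≤ o
    1≤o = proj₁ desc

    o≤c : o ≤ c
    o≤c = proj₁ (proj₂ desc)

    c≤n : c ≤ n
    c≤n = ≤-trans (n≤1+n c) sc≤n

    o≤n : o ≤ n
    o≤n = ≤-trans o≤c c≤n

    β+d<n∸c : β + d < n ∸ c
    β+d<n∸c = ≤-reflexive (sym (trans n∸c≡ (cong (_+ d) (pendingLength-∷ g o ps))))

    β<n∸c : β < n ∸ c
    β<n∸c = ≤-<-trans (m≤m+n β d) β+d<n∸c

    β<oHome : β < oHome
    β<oHome = <-≤-trans β<n∸c (∸-monoʳ-≤ n o≤c)

    o-at-β : occupant s β ≡ just o
    o-at-β = trans (cong (λ u → occupant u β) (goodStreet-∷ c g o ps d))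
                   (occupant-++ʳ (pendingZone ps ++ emptyStreet g) _ (trans (cong (_+ 0) (length-pendingZone-gap ps g)) (+-identityʳ β)))

    oHome-free : occupant s oHome ≡ nothing
    oHome-free = trans (cong (λ u → occupant u oHome) (sym (++-assoc (pendingZone ((g , o) ∷ ps)) (emptyStreet d) _)))
      (trans (occupant-++ʳ (pendingZone ((g , o) ∷ ps) ++ emptyStreet d) (finalZone c ((g , o) ∷ ps)) offset)
             (occupant-finalZone-pending c ((g , o) ∷ ps) o (isPending-head g o ps) 1≤o o≤c))
      where
      offset : length (pendingZone ((g , o) ∷ ps) ++ emptyStreet d) + (c ∸ o) ≡ oHome
      offset = trans (cong (_+ (c ∸ o)) (trans (length-pendingZone-gap ((g , o) ∷ ps) d) (sym n∸c≡)))
                     (trans (sym (+-∸-assoc (n ∸ c) o≤c)) (cong (_∸ o) (m∸n+n≡m c≤n)))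

    oHome<length : oHome < length s
    oHome<length = subst (oHome <_) (sym W.length≡n) (∸-monoʳ-< {o = 0} 1≤o o≤n)

    -- Parking to the left of the rightmost pending car o either puts a larger car before o,
    -- or bumps a car that cannot get past o's empty final spot, or bumps a car larger than o.
    left-of-last-doomed : ∀ {k t} → k < β → Arrival (suc c) k s t → Doomed (suc c) t
    left-of-last-doomed {k} k<β a with Arrival.cases a
    ... | inj₁ v = crossing-or-misplaced o (suc c) β k (s≤s o≤c) ≤-refl
      (trans (Vacant.others v β (λ β≡k → <⇒≢ k<β (sym β≡k))) o-at-β) (Arrival.parks a) k<β (<⇒≢ β<oHome)
    ... | inj₂ b with <-cmp (Bumps.car b) o
    ...   | tri≈ _ refl _ = ⊥-elim (<⇒≢ k<β (W.injective k β o (Bumps.bumped b) o-at-β))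
    ...   | tri< y<o _ _  = crossing-or-misplaced (Bumps.car b) (suc c) (Bumps.dest b) k
      (s≤s (proj₂ (W.car-range k _ (Bumps.bumped b)))) ≤-refl (Bumps.lands b) (Arrival.parks a) (Bumps.k<dest b)
      (<⇒≢ (≤-<-trans (Bumps.earliest b oHome (<-trans k<β β<oHome) oHome<length oHome-free) (∸-monoʳ-< y<o o≤n)))
    ...   | tri> _ _ o<y  = crossing-arrival sc≤n W crossing a
      where
      crossing : Crossing c s
      crossing = record
        { small = o ; big = Bumps.car b ; small<big = o<y ; big≤c = proj₂ (W.car-range k _ (Bumps.bumped b))
        ; smallSpot = β ; bigSpot = k ; small-occupies = o-at-β ; big-occupies = Bumps.bumped b
        ; big-left = k<β ; open-zone = β<n∸c }

    bump-last-doomed : ∀ {t} → 1 ≤ d → Arrival (suc c) β s t → Doomed (suc c) t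
    bump-last-doomed 1≤d a with Arrival.cases a
    ... | inj₁ v = ⊥-elim (just≢nothing (trans (sym o-at-β) (Vacant.free v)))
    ... | inj₂ b with just-injective (trans (sym (Bumps.bumped b)) o-at-β)
    ...   | refl = crossing-or-misplaced o (suc c) (Bumps.dest b) β (s≤s o≤c) ≤-refl
      (Bumps.lands b) (Arrival.parks a) (Bumps.k<dest b) (<⇒≢ (≤-<-trans dest≤sβ sβ<oHome))
      where
      after-β-free : occupant s (suc β) ≡ nothing
      after-β-free = trans (cong (λ u → occupant u (suc β)) (goodStreet-∷ c g o ps d))
        (trans (occupant-++ʳ (pendingZone ps ++ emptyStreet g) _ (trans (cong (_+ 1) (length-pendingZone-gap ps g)) (+-comm _ 1)))
               (occupant-emptyStreet-++ d _ 1≤d))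
      sβ<n∸c : suc β < n ∸ c
      sβ<n∸c = ≤-<-trans (subst (_≤ β + d) (+-comm β 1) (+-monoʳ-≤ β 1≤d)) β+d<n∸c
      sβ<oHome : suc β < oHome
      sβ<oHome = <-≤-trans sβ<n∸c (∸-monoʳ-≤ n o≤c)
      dest≤sβ : Bumps.dest b ≤ suc β
      dest≤sβ = Bumps.earliest b (suc β) ≤-refl (<-trans sβ<oHome oHome<length) after-β-free

  pending-zone-doomed : ∀ {c ps d k t} → 1 ≤ d → suc c ≤ n → n ∸ c ≡ pendingLength ps + d → Descending c ps →
    WellFormed c (goodStreet c ps d) → k < pendingLength ps → Arrival (suc c) k (goodStreet c ps d) t → Doomed (suc c) t
  pending-zone-doomed {ps = []} _ _ _ _ _ ()
  pending-zone-doomed {ps = (g , o) ∷ ps} {k = k} 1≤d sc≤n n∸c≡ desc W k< a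
    with m≤n⇒m<n∨m≡n (s≤s⁻¹ (subst (k <_) (pendingLength-∷ g o ps) k<))
  ... | inj₁ k<β = LastPending.left-of-last-doomed sc≤n n∸c≡ desc W k<β a
  ... | inj₂ refl = LastPending.bump-last-doomed sc≤n n∸c≡ desc W 1≤d a

  CompletionsFormula : ℕ → Set
  CompletionsFormula m = ∀ c ps d → c + m ≡ n → pendingLength ps + d ≡ m → Descending c ps →
    WellFormed c (goodStreet c ps d) → completions (suc c) (goodStreet c ps d) m ≡ weight ps d

  completionsVia-good : ∀ {c m} s k {ps d} → CompletionsFormula m → suc c + m ≡ n → WellFormed c s →
    arrive (suc c) k s ≡ just (goodStreet (suc c) ps d) → pendingLength ps + d ≡ m → Descending (suc c) ps →
    completionsVia (suc c) s m k ≡ weight ps d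
  completionsVia-good {c} {m} s k IH sc+m≡n W parks len desc = trans (completionsVia-park (suc c) s m k parks)
    (IH _ _ _ sc+m≡n len desc (wellFormed-arrival W (arrive-spec _ _ _ parks)))

  completionsVia-push : ∀ {m} → CompletionsFormula m → ∀ {c ps e} t f → t + suc f ≡ e → suc c + m ≡ n →
    pendingLength ps + e ≡ m → Descending c ps → WellFormed c (goodStreet c ps (suc e)) →
    completionsVia (suc c) (goodStreet c ps (suc e)) m (pendingLength ps + t) ≡ weight ((t , suc c) ∷ ps) f
  completionsVia-push {m} IH {c} {ps} t f refl sc+m≡n len desc W =
    completionsVia-good s (α + t) IH sc+m≡n W parks len′ (s≤s z≤n , ≤-refl , desc)
    where
    s = goodStreet c ps (suc (t + suc f))
    α = pendingLength ps
    parks : arrive (suc c) (α + t) s ≡ just (goodStreet (suc c) ((t , suc c) ∷ ps) f)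
    parks = subst (λ d → arrive (suc c) (α + t) (goodStreet c ps d) ≡ just (goodStreet (suc c) ((t , suc c) ∷ ps) f))
                  (+-suc t (suc f)) (arrive-push c ps t f)
    len′ : pendingLength ((t , suc c) ∷ ps) + f ≡ m
    len′ = begin
      pendingLength ((t , suc c) ∷ ps) + f ≡⟨ cong (_+ f) (pendingLength-∷ t (suc c) ps) ⟩
      suc (α + t + f)                      ≡⟨ cong suc (+-assoc α t f) ⟩
      suc (α + (t + f))                    ≡⟨ +-suc α (t + f) ⟨
      α + suc (t + f)                      ≡⟨ cong (α +_) (+-suc t f) ⟨
      α + (t + suc f)                      ≡⟨ len ⟩
      m                                    ∎

  completions-open : ∀ {m} → CompletionsFormula m → ∀ c ps e → c + suc m ≡ n → pendingLength ps + suc e ≡ suc m →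
    Descending c ps → WellFormed c (goodStreet c ps (suc e)) →
    completions (suc c) (goodStreet c ps (suc e)) (suc m) ≡ weight ps (suc e)
  completions-open {m} IH c ps e c+sm≡n len desc W = begin
    completions (suc c) s (suc m)
      ≡⟨ completions-suc (suc c) s m ⟩
    ∑ n T
      ≡⟨ cong (λ z → ∑ z T) n≡ ⟩
    ∑ (α + (suc e + c)) T
      ≡⟨ ∑-window α (suc e) c T pending-spots final-spots ⟩
    ∑[ k < suc e ] T (α + k)
      ≡⟨ ∑-suc e (λ k → T (α + k)) ⟩
    (∑[ t < e ] T (α + t)) + T (α + e)
      ≡⟨ cong₂ _+_ (∑-cong e push) home ⟩
    (∑[ t < e ] weight ((t , suc c) ∷ ps) (e ∸ suc t)) + weight ps e
      ≡⟨ weight-suc (suc c) ps e ⟨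
    weight ps (suc e)
      ∎
    where
    s = goodStreet c ps (suc e)
    T = completionsVia (suc c) s m
    α = pendingLength ps
    sc≤n : suc c ≤ n
    sc≤n = arrivals-left c+sm≡n
    sc+m≡n : suc c + m ≡ n
    sc+m≡n = trans (sym (+-suc c m)) c+sm≡n
    n∸c≡ : n ∸ c ≡ α + suc e
    n∸c≡ = open-zone-length c+sm≡n len
    n≡ : n ≡ α + (suc e + c)
    n≡ = trans (sym c+sm≡n) (trans (cong (c +_) (sym len)) (trans (+-comm c _) (+-assoc α (suc e) c)))
    α+e≡m : α + e ≡ m
    α+e≡m = suc-injective (trans (sym (+-suc α e)) len)
    final-zone : ∀ k → n ∸ c ≤ α + (suc e + k)
    final-zone k = subst (_≤ α + (suc e + k)) (sym n∸c≡) (+-monoʳ-≤ α (m≤m+n (suc e) k))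
    pending-spots : ∀ k → k < α → T k ≡ 0
    pending-spots k k<α = completionsVia-doomed s k sc+m≡n W (pending-zone-doomed (s≤s z≤n) sc≤n n∸c≡ desc W k<α)
    final-spots : ∀ k → k < c → T (α + (suc e + k)) ≡ 0
    final-spots k _ = completionsVia-doomed s _ sc+m≡n W (inj₁ ∘ newcomer-misplaced sc≤n (final-zone k))
    push : ∀ t → t < e → T (α + t) ≡ weight ((t , suc c) ∷ ps) (e ∸ suc t)
    push t t<e = completionsVia-push IH t (e ∸ suc t) (trans (+-suc t _) (m+[n∸m]≡n t<e)) sc+m≡n α+e≡m desc W
    home : T (α + e) ≡ weight ps e
    home = completionsVia-good s (α + e) IH sc+m≡n W (arrive-home c ps e desc) α+e≡m (Descending-weaken ps (n≤1+n c) desc)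

  completions-closed : ∀ {m} → CompletionsFormula m → ∀ c g o ps → c + suc m ≡ n →
    pendingLength ((g , o) ∷ ps) + 0 ≡ suc m → Descending c ((g , o) ∷ ps) → WellFormed c (goodStreet c ((g , o) ∷ ps) 0) →
    completions (suc c) (goodStreet c ((g , o) ∷ ps) 0) (suc m) ≡ weight ((g , o) ∷ ps) 0
  completions-closed {m} IH c g o ps c+sm≡n len desc@(_ , o≤c , ps-desc) W = begin
    completions (suc c) s (suc m)
      ≡⟨ completions-suc (suc c) s m ⟩
    ∑ n T
      ≡⟨ cong (λ z → ∑ z T) n≡ ⟩
    ∑ (β + (1 + c)) T
      ≡⟨ ∑-window β 1 c T pending-spots final-spots ⟩
    T (β + 0) + 0
      ≡⟨ +-identityʳ _ ⟩
    T (β + 0)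
      ≡⟨ completionsVia-good s (β + 0) IH sc+m≡n W parks β≡m rest-descending ⟩
    weight ps g
      ≡⟨ weight-bump g o ps ⟨
    weight ((g , o) ∷ ps) 0
      ∎
    where
    s = goodStreet c ((g , o) ∷ ps) 0
    T = completionsVia (suc c) s m
    β = pendingLength ps + g
    sc≤n : suc c ≤ n
    sc≤n = arrivals-left c+sm≡n
    sc+m≡n : suc c + m ≡ n
    sc+m≡n = trans (sym (+-suc c m)) c+sm≡n
    n∸c≡ : n ∸ c ≡ pendingLength ((g , o) ∷ ps) + 0
    n∸c≡ = open-zone-length c+sm≡n len
    β≡m : β ≡ m
    β≡m = suc-injective (trans (sym (trans (+-identityʳ _) (pendingLength-∷ g o ps))) len)
    n≡ : n ≡ β + (1 + c)
    n≡ = trans (sym c+sm≡n) (trans (cong (λ z → c + suc z) (sym β≡m)) (trans (+-comm c (suc β)) (sym (+-suc β c))))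
    final-zone : ∀ k → n ∸ c ≤ β + (1 + k)
    final-zone k = subst (_≤ β + (1 + k)) (sym n∸c≡β+1) (+-monoʳ-≤ β (s≤s z≤n))
      where
      n∸c≡β+1 : n ∸ c ≡ β + 1
      n∸c≡β+1 = trans n∸c≡ (trans (+-identityʳ _) (trans (pendingLength-∷ g o ps) (+-comm 1 β)))
    pending-spots : ∀ k → k < β → T k ≡ 0
    pending-spots k k<β = completionsVia-doomed s k sc+m≡n W (LastPending.left-of-last-doomed sc≤n n∸c≡ desc W k<β)
    final-spots : ∀ k → k < c → T (β + (1 + k)) ≡ 0
    final-spots k _ = completionsVia-doomed s _ sc+m≡n W (inj₁ ∘ newcomer-misplaced sc≤n (final-zone k))
    rest-descending : Descending (suc c) ps
    rest-descending = Descending-weaken ps (≤-trans pred[n]≤n (≤-trans o≤c (n≤1+n c))) ps-desc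
    parks : arrive (suc c) (β + 0) s ≡ just (goodStreet (suc c) ps g)
    parks = subst (λ k → arrive (suc c) k s ≡ just (goodStreet (suc c) ps g)) (sym (+-identityʳ β)) (arrive-bump-home c g o ps desc)

  completions-formula : ∀ m → CompletionsFormula m
  completions-formula zero c ps d c+0≡n len desc W with pendingLength-zero ps d len
  ... | refl , refl rewrite trans (sym (+-identityʳ c)) c+0≡n | succeeds-finalZone = refl
  completions-formula (suc m) c ps (suc e) = completions-open (completions-formula m) c ps e
  completions-formula (suc m) c [] zero _ ()
  completions-formula (suc m) c ((g , o) ∷ ps) zero = completions-closed (completions-formula m) c g o ps

  wellFormed-emptyStreet : WellFormed 0 (emptyStreet n)
  wellFormed-emptyStreet = record
    { length≡n = length-emptyStreet n
    ; car-range = λ r x occ → ⊥-elim (empty r occ)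
    ; injective = λ r _ x occ _ → ⊥-elim (empty r occ) }
    where
    empty : ∀ r {x} → occupant (emptyStreet n) r ≢ just x
    empty r occ = just≢nothing (trans (sym occ) (occupant-emptyStreet n r))

  length-fiber-w₀ : length (fiberMVP n (w₀ n)) ≡ length (Motzkin n)
  length-fiber-w₀ = begin
    length (fiberMVP n (w₀ n))                ≡⟨ length-filterᵇ _ (prefSeqs n) ⟩
    count (hasOutcome n (w₀ n)) (prefSeqs n)  ≡⟨ count-cong hasOutcome-w₀ (prefSeqs n) ⟩
    completions 1 (emptyStreet n) n           ≡⟨ cong (λ s → completions 1 s n) empty≡ ⟨
    completions 1 (goodStreet 0 [] n) n       ≡⟨ completions-formula n 0 [] n refl refl tt
                                                   (subst (WellFormed 0) (sym empty≡) wellFormed-emptyStreet) ⟩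
    1 * motzkin n                             ≡⟨ *-identityˡ (motzkin n) ⟩
    motzkin n                                 ≡⟨ length-Motzkin n ⟨
    length (Motzkin n)                        ∎
    where
    empty≡ : goodStreet 0 [] n ≡ emptyStreet n
    empty≡ = ++-identityʳ (emptyStreet n)

-- The count is 1 = M(0) also for n = 0.
theorem4p4 : (n : ℕ) → n ≥ 1 → length (fiberMVP n (w₀ n)) ≡ length (Motzkin n)
theorem4p4 n _ = length-fiber-w₀ n
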